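{- Let $k \geq 5$ be an integer and $n = 2k+1$. Then there exists a near-Skolem sequence or a hooked near-Skolem sequence of order $n$ with defect $n-1$ which has no right endpoints in the positions $1,2,\ldots,k+2$.
   Context: A Skolem-type sequence of order $n$ is a sequence $(s_1,\ldots,s_{2n})$ of $2n$ integers such that, for some set $H$ of $n$ distinct positive integers, each $h\in H$ occurs in exactly two positions $i<j$, and then $j-i=h$. A hooked Skolem-type sequence of order $n$ is a sequence $(s_1,\ldots,s_{2n+1})$ of $2n+1$ integers with $s_{2n}=0$ which otherwise satisfies the same conditions (each $h\in H$ occurs in exactly two positions $i<j$ with $j-i=h$, and all other positions are filled by these occurrences). For positive integers $m\le n$, a near-Skolem sequence (resp. hooked near-Skolem sequence) of order $n$ and defect $m$ is a Skolem-type sequence (resp. hooked Skolem-type sequence) of order $n-1$ with $H=[1,m-1]\cup[m+1,n]$; so it has length $2n-2$ (resp. $2n-1$). If $h\in H$ occurs in positions $i<j$, then $j$ is called a right endpoint. Here $[a,b]$ denotes $\{x\in\mathbb{N}: a\le x\le b\}$. -}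

module Defs where

open import Data.Nat using (ℕ; zero; suc; _+_; _*_; _∸_; _≤_; _<_)
open import Data.Fin using (Fin; toℕ)
open import Data.Product using (Σ; _×_)
open import Data.Sum using (_⊎_)
open import Data.Empty using (⊥)
open import Relation.Binary.PropositionalEquality using (_≡_; _≢_)

-- Sequences of length L are functions Fin L → ℕ; the 1-indexed position of
-- index i is  pos i = toℕ i + 1.
pos : ∀ {L} → Fin L → ℕ
pos i = suc (toℕ i)

OccursAsPair : ∀ {L} → (Fin L → ℕ) → ℕ → Set
OccursAsPair {L} s h =
  Σ (Fin L) λ i → Σ (Fin L) λ j →
    pos i < pos j × pos j ≡ pos i + h × s i ≡ h × s j ≡ h ×
    (∀ p → s p ≡ h → (p ≡ i ⊎ p ≡ j))

IsSkolemType : (n : ℕ) → (H : ℕ → Set) → (Fin (2 * n) → ℕ) → Set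
IsSkolemType n H s = (∀ h → H h → OccursAsPair s h) × (∀ p → H (s p))

IsHookedSkolemType : (n : ℕ) → (H : ℕ → Set) → (Fin (suc (2 * n)) → ℕ) → Set
IsHookedSkolemType n H s =
  (∀ h → H h → OccursAsPair s h) ×
  (∀ p → pos p ≡ 2 * n → s p ≡ 0) ×
  (∀ p → pos p ≢ 2 * n → H (s p))

NearSet : ℕ → ℕ → ℕ → Set
NearSet n m h = 1 ≤ h × h ≤ n × h ≢ m

IsNearSkolem : (n m : ℕ) → (Fin (2 * (n ∸ 1)) → ℕ) → Set
IsNearSkolem n m s = IsSkolemType (n ∸ 1) (NearSet n m) s

IsHookedNearSkolem : (n m : ℕ) → (Fin (suc (2 * (n ∸ 1))) → ℕ) → Set
IsHookedNearSkolem n m s = IsHookedSkolemType (n ∸ 1) (NearSet n m) s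

RightEndpoint : ∀ {L} → (H : ℕ → Set) → (Fin L → ℕ) → Fin L → Set
RightEndpoint {L} H s j =
  H (s j) × Σ (Fin L) λ i → pos i < pos j × s i ≡ s j × pos j ≡ pos i + s j

NoRightEndpointUpTo : ∀ {L} → (H : ℕ → Set) → (Fin L → ℕ) → ℕ → Set
NoRightEndpointUpTo {L} H s b = ∀ (j : Fin L) → pos j ≤ b → RightEndpoint H s j → ⊥

-- Both sequences are assembled from rainbows: the values b, b + 2, …, b + 2(m − 1), written once
-- in decreasing and once in increasing order, the increasing run starting b + m − 1 places after
-- the decreasing one, so that every value v recurs at distance v. For k = 6 + 2t (hooked) and
-- k = 5 + 2t (plain) seven rainbows tile the positions, their values are exactly
-- [1, 2k + 1] ∖ {2k}, and every increasing run starts after position k + 2, so no right endpoint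
-- lies there. All positions and values are linear forms in t, so checking such a layout amounts to
-- comparing coefficients, which is done by computation; a generic argument turns a checked layout
-- into the sequence, through the function sending each value to its first occurrence.

module Submission where

open import Defs
open import Data.Bool using (Bool; true; false; T; _∧_; not)
open import Data.Bool.Properties using (T-∧)
open import Data.Nat
  using (ℕ; zero; suc; _+_; _*_; _∸_; _≤_; _<_; z≤n; s≤s; s≤s⁻¹; _≡ᵇ_; _≤ᵇ_; ⌊_/2⌋; _<?_; _≤?_)
open import Data.Nat.Properties
open import Data.Nat.Tactic.RingSolver using (solve-∀)
open import Data.List using (List; []; _∷_; _++_)
open import Data.Bool.ListAction using (all; any)
open import Data.List.Membership.Propositional using (_∈_; find)
open import Data.List.Membership.Propositional.Properties using (∈-++⁻; ∈-++⁺ˡ; ∈-++⁺ʳ)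
open import Data.List.Relation.Unary.All as All using (All)
open import Data.List.Relation.Unary.All.Properties using (all⁺)
open import Data.List.Relation.Unary.Any as Any using (here; there)
open import Data.List.Relation.Unary.Any.Properties using (any⁻)
open import Data.Fin using (Fin; toℕ; fromℕ<)
open import Data.Fin.Properties using (toℕ-injective; toℕ-fromℕ<; toℕ<n)
open import Data.Product using (Σ; ∃; _×_; _,_; proj₁; proj₂)
open import Data.Sum using (_⊎_; inj₁; inj₂)
open import Function using (_∘_; Equivalence)
open import Relation.Nullary using (yes; no; contradiction)
open import Relation.Binary.PropositionalEquality

record Lin : Set where
  constructor lin
  field
    const slope : ℕ

infixl 6 _⊕_
infix 8 #_
infix 4 _=ᴸ_ _≤ᴸ_
_⊕_ : Lin → Lin → Lin
lin a b ⊕ lin c d = lin (a + c) (b + d)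

#_ : ℕ → Lin
# a = lin a 0

-- Rounds each coefficient down, so it halves c + d·t only for even d; `parityOK` checks every base.
halfᴸ : Lin → Lin
halfᴸ (lin a b) = lin ⌊ a /2⌋ ⌊ b /2⌋

⟦_⟧ : Lin → ℕ → ℕ
⟦ lin a b ⟧ t = a + b * t

⟦⊕⟧ : ∀ x y t → ⟦ x ⊕ y ⟧ t ≡ ⟦ x ⟧ t + ⟦ y ⟧ t
⟦⊕⟧ (lin a b) (lin c d) t = lemma a b c d t
  where
  lemma : ∀ a b c d t → a + c + (b + d) * t ≡ a + b * t + (c + d * t)
  lemma = solve-∀

_=ᴸ_ : Lin → Lin → Bool
lin a b =ᴸ lin c d = (a ≡ᵇ c) ∧ (b ≡ᵇ d)

_≤ᴸ_ : Lin → Lin → Bool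
lin a b ≤ᴸ lin c d = (a ≤ᵇ c) ∧ (b ≤ᵇ d)

=ᴸ-sound : ∀ x y → T (x =ᴸ y) → x ≡ y
=ᴸ-sound (lin a b) (lin c d) eq with Equivalence.to T-∧ eq
... | a≡c , b≡d = cong₂ lin (≡ᵇ⇒≡ a c a≡c) (≡ᵇ⇒≡ b d b≡d)

⟦⟧-cong : ∀ x y → T (x =ᴸ y) → ∀ t → ⟦ x ⟧ t ≡ ⟦ y ⟧ t
⟦⟧-cong x y eq t = cong (λ z → ⟦ z ⟧ t) (=ᴸ-sound x y eq)

⟦⟧-mono : ∀ {x y} → T (x ≤ᴸ y) → ∀ t → ⟦ x ⟧ t ≤ ⟦ y ⟧ t
⟦⟧-mono {lin a b} {lin c d} le t with Equivalence.to T-∧ le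
... | a≤c , b≤d = +-mono-≤ (≤ᵇ⇒≤ a c a≤c) (*-monoˡ-≤ t (≤ᵇ⇒≤ b d b≤d))

split₄ : ∀ a b c d → T (a ∧ b ∧ c ∧ d) → T a × T b × T c × T d
split₄ true true true true _ = _ , _ , _ , _
split₄ true true true false ()
split₄ true true false _ ()
split₄ true false _ _ ()
split₄ false _ _ _ ()

module BoolMembership {A : Set} (_==_ : A → A → Bool) (sound : ∀ x y → T (x == y) → x ≡ y) where

  infix 4 _∈?_
  _∈?_ : A → List A → Bool
  x ∈? xs = any (x ==_) xs

  ∈?-sound : ∀ x xs → T (x ∈? xs) → x ∈ xs
  ∈?-sound x xs ok = Any.map (sound x _) (any⁻ (x ==_) xs ok)

module Tiling {I : Set} (start width : I → Lin) where

  tiles? : List I → Lin → Lin → Bool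
  tiles? [] o e = o =ᴸ e
  tiles? (x ∷ xs) o e = (start x =ᴸ o) ∧ tiles? xs (o ⊕ width x) e

  module _ (t : ℕ) (val : I → ℕ → ℕ) where

    startₜ widthₜ : I → ℕ
    startₜ x = ⟦ start x ⟧ t
    widthₜ x = ⟦ width x ⟧ t

    Tiles : List I → ℕ → ℕ → Set
    Tiles [] o e = o ≡ e
    Tiles (x ∷ xs) o e = startₜ x ≡ o × Tiles xs (o + widthₜ x) e

    tiles?-sound : ∀ xs o e → T (tiles? xs o e) → Tiles xs (⟦ o ⟧ t) (⟦ e ⟧ t)
    tiles?-sound [] o e ok = ⟦⟧-cong o e ok t
    tiles?-sound (x ∷ xs) o e ok with Equivalence.to T-∧ ok
    ... | here-ok , rest-ok =
      ⟦⟧-cong (start x) o here-ok t ,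
      subst (λ o′ → Tiles xs o′ (⟦ e ⟧ t)) (⟦⊕⟧ o (width x) t) (tiles?-sound xs (o ⊕ width x) e rest-ok)

    lookupAt : List I → ℕ → ℕ
    lookupAt [] p = 0
    lookupAt (x ∷ xs) p with p <? startₜ x + widthₜ x
    ... | yes _ = val x (p ∸ startₜ x)
    ... | no _ = lookupAt xs p

    tiles-≤ : ∀ {xs o e} → Tiles xs o e → o ≤ e
    tiles-≤ {[]} refl = ≤-refl
    tiles-≤ {x ∷ xs} {o} (_ , rest) = ≤-trans (m≤m+n o (widthₜ x)) (tiles-≤ rest)

    tiles-bounds : ∀ {xs o e x} → Tiles xs o e → x ∈ xs → o ≤ startₜ x × startₜ x + widthₜ x ≤ e
    tiles-bounds (refl , rest) (here refl) = ≤-refl , tiles-≤ rest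
    tiles-bounds {y ∷ _} {o} (_ , rest) (there x∈xs) with tiles-bounds rest x∈xs
    ... | o+w≤start , end≤e = ≤-trans (m≤m+n o (widthₜ y)) o+w≤start , end≤e

    lookupAt-∈ : ∀ {xs o e x r} → Tiles xs o e → x ∈ xs → r < widthₜ x →
                 lookupAt xs (startₜ x + r) ≡ val x r
    lookupAt-∈ {x = x} {r} _ (here refl) r<w with startₜ x + r <? startₜ x + widthₜ x
    ... | yes _ = cong (val x) (m+n∸m≡n (startₜ x) r)
    ... | no r≮w = contradiction (+-monoʳ-< (startₜ x) r<w) r≮w
    lookupAt-∈ {y ∷ _} {x = x} {r} (refl , rest) (there x∈xs) r<w with startₜ x + r <? startₜ y + widthₜ y
    ... | yes early =
      contradiction early (≤⇒≯ (≤-trans (proj₁ (tiles-bounds rest x∈xs)) (m≤m+n (startₜ x) r)))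
    ... | no _ = lookupAt-∈ rest x∈xs r<w

    tiles-locate : ∀ {xs o e p} → Tiles xs o e → o ≤ p → p < e →
                   ∃ λ x → x ∈ xs × ∃ λ r → r < widthₜ x × p ≡ startₜ x + r
    tiles-locate {[]} refl o≤p p<e = contradiction o≤p (<⇒≱ p<e)
    tiles-locate {y ∷ _} {o} {p = p} (refl , rest) o≤p p<e with p <? o + widthₜ y
    ... | yes p<end =
      y , here refl , p ∸ o , +-cancelˡ-< o (p ∸ o) (widthₜ y) (subst (_< o + widthₜ y) p≡ p<end) , p≡
      where
      p≡ : p ≡ o + (p ∸ o)
      p≡ = sym (m+[n∸m]≡n o≤p)
    ... | no p≮end with tiles-locate rest (≮⇒≥ p≮end) p<e
    ...   | x , x∈xs , found = x , there x∈xs , found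

-- `first h` is the left endpoint of h, and Hole is where a hooked sequence has its 0.
module Pairing {H Hole : ℕ → Set} (s first : ℕ → ℕ) (L B : ℕ)
  (positive : ∀ {h} → H h → 1 ≤ h)
  (hole-zero : ∀ {p} → Hole p → s p ≡ 0)
  (pairs : ∀ {h} → H h →
           s (first h) ≡ h × s (first h + h) ≡ h × first h + h < L × B ≤ first h + h)
  (covers : ∀ {p} → p < L →
            Hole p ⊎ H (s p) × (p ≡ first (s p) ⊎ p ≡ first (s p) + s p))
  where

  seq : Fin L → ℕ
  seq i = s (toℕ i)

  endpoint : ∀ p → H (seq p) → toℕ p ≡ first (seq p) ⊎ toℕ p ≡ first (seq p) + seq p
  endpoint p hp with covers (toℕ<n p)
  ... | inj₁ hole = contradiction (subst H (hole-zero hole) hp) (λ h0 → 1+n≰n (positive h0))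
  ... | inj₂ (_ , e) = e

  occurs : ∀ h → H h → OccursAsPair seq h
  occurs h hh = i , j , pos-i<pos-j , cong suc (trans toℕ-j (sym (cong (_+ h) toℕ-i))) ,
                trans (cong s toℕ-i) s-first , trans (cong s toℕ-j) s-second , only
    where
    s-first = proj₁ (pairs hh)
    s-second = proj₁ (proj₂ (pairs hh))
    second<L = proj₁ (proj₂ (proj₂ (pairs hh)))
    first<L : first h < L
    first<L = ≤-<-trans (m≤m+n (first h) h) second<L
    i j : Fin L
    i = fromℕ< first<L
    j = fromℕ< second<L
    toℕ-i : toℕ i ≡ first h
    toℕ-i = toℕ-fromℕ< first<L
    toℕ-j : toℕ j ≡ first h + h
    toℕ-j = toℕ-fromℕ< second<L
    pos-i<pos-j : pos i < pos j
    pos-i<pos-j rewrite toℕ-i | toℕ-j =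
      s≤s (subst (_≤ first h + h) (+-comm (first h) 1) (+-monoʳ-≤ (first h) (positive hh)))
    only : ∀ p → seq p ≡ h → p ≡ i ⊎ p ≡ j
    only p refl with endpoint p hh
    ... | inj₁ e = inj₁ (toℕ-injective (trans e (sym toℕ-i)))
    ... | inj₂ e = inj₂ (toℕ-injective (trans e (sym toℕ-j)))

  no-early-right-endpoint : NoRightEndpointUpTo H seq B
  no-early-right-endpoint j pos-j≤B (hj , i , pos-i<pos-j , same , _) with endpoint j hj
  ... | inj₂ j-second =
    contradiction (≤-trans (proj₂ (proj₂ (proj₂ (pairs hj)))) (≤-reflexive (sym j-second))) (<⇒≱ pos-j≤B)
  ... | inj₁ j-first with endpoint i (subst H (sym same) hj)
  ...   | inj₁ i-first = <-irrefl (cong suc (trans i-first (trans (cong first same) (sym j-first)))) pos-i<pos-j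
  ...   | inj₂ i-second = contradiction pos-i<pos-j (≤⇒≯ (s≤s j≤i))
    where
    open ≤-Reasoning
    j≤i : toℕ j ≤ toℕ i
    j≤i = begin
      toℕ j                          ≡⟨ j-first ⟩
      first (seq j)                  ≤⟨ m≤m+n _ (seq j) ⟩
      first (seq j) + seq j          ≡⟨ cong (λ v → first v + v) (sym same) ⟩
      first (seq i) + seq i          ≡⟨ i-second ⟨
      toℕ i                          ∎

data Parity : Set where
  even odd : Parity

bit : Parity → ℕ
bit even = 0
bit odd = 1

parity : ∀ h → ∃ λ π → ∃ λ u → h ≡ bit π + (u + u)
parity zero = even , 0 , refl
parity (suc zero) = odd , 0 , refl
parity (suc (suc h)) with parity h
... | even , u , refl = even , suc u , cong suc (sym (+-suc u u))
... | odd , u , refl = odd , suc u , cong (suc ∘ suc) (sym (+-suc u u))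

odd≢even : ∀ u v → suc (u + u) ≢ v + v
odd≢even zero (suc v) eq = 0≢1+n (trans (suc-injective eq) (+-suc v v))
odd≢even (suc u) (suc v) eq rewrite +-suc u u | +-suc v v = odd≢even u v (suc-injective (suc-injective eq))

halve-≤ : ∀ {u k} → u + u ≤ k + k → u ≤ k
halve-≤ {u} {k} le with u ≤? k
... | yes u≤k = u≤k
... | no u≰k = contradiction le (<⇒≱ (+-mono-< (≰⇒> u≰k) (≰⇒> u≰k)))

halve-< : ∀ {u k} → u + u < k + k → u < k
halve-< {u} {k} lt with u <? k
... | yes u<k = u<k
... | no u≮k = contradiction lt (≤⇒≯ (+-mono-≤ (≮⇒≥ u≮k) (≮⇒≥ u≮k)))

byParity : (Parity → ℕ → ℕ) → ℕ → ℕ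
byParity f zero = f even 0
byParity f (suc zero) = f odd 0
byParity f (suc (suc h)) = byParity (λ π → f π ∘ suc) h

byParity-at : ∀ f π u → byParity f (bit π + (u + u)) ≡ f π u
byParity-at f even zero = refl
byParity-at f odd zero = refl
byParity-at f even (suc u) rewrite +-suc u u = byParity-at (λ π → f π ∘ suc) even u
byParity-at f odd (suc u) rewrite +-suc u u = byParity-at (λ π → f π ∘ suc) odd u

lowestHalf : Parity → ℕ
lowestHalf even = 1
lowestHalf odd = 0

halfBound : Parity → ℕ → ℕ
halfBound even k = k
halfBound odd k = suc k

defect≡ : ∀ k → (2 * k + 1) ∸ 1 ≡ k + k
defect≡ k = trans (m+n∸n≡m (2 * k) 1) (cong (k +_) (+-identityʳ k))

order≡ : ∀ k → 2 * k + 1 ≡ suc (k + k)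
order≡ k = trans (+-comm (2 * k) 1) (cong (λ m → suc (k + m)) (+-identityʳ k))

near-by-half : ∀ k π u → lowestHalf π ≤ u → u < halfBound π k →
               NearSet (2 * k + 1) ((2 * k + 1) ∸ 1) (bit π + (u + u))
near-by-half k even u 1≤u u<k =
  ≤-trans 1≤u (m≤m+n u u) ,
  ≤-trans (<⇒≤ 2u<2k) (≤-trans (n≤1+n _) (≤-reflexive (sym (order≡ k)))) ,
  λ eq → <⇒≢ 2u<2k (trans eq (defect≡ k))
  where
  2u<2k = +-mono-< u<k u<k
near-by-half k odd u _ (s≤s u≤k) =
  s≤s z≤n ,
  ≤-trans (s≤s (+-mono-≤ u≤k u≤k)) (≤-reflexive (sym (order≡ k))) ,
  λ eq → odd≢even u k (trans eq (defect≡ k))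

half-of-near : ∀ k h → NearSet (2 * k + 1) ((2 * k + 1) ∸ 1) h →
               ∃ λ π → ∃ λ u → h ≡ bit π + (u + u) × lowestHalf π ≤ u × u < halfBound π k
half-of-near k h (1≤h , h≤n , h≢d) with parity h
... | odd , u , refl =
  odd , u , refl , z≤n , s≤s (halve-≤ (s≤s⁻¹ (≤-trans h≤n (≤-reflexive (order≡ k)))))
... | even , zero , refl = contradiction 1≤h λ ()
... | even , suc u , refl = even , suc u , refl , s≤s z≤n , halve-< 2u<2k
  where
  2u≤2k : suc u + suc u ≤ k + k
  2u≤2k = s≤s⁻¹ (≤∧≢⇒< (≤-trans h≤n (≤-reflexive (order≡ k)))
                        λ eq → odd≢even k (suc u) (sym eq))
  2u<2k : suc u + suc u < k + k
  2u<2k = ≤∧≢⇒< 2u≤2k (λ eq → h≢d (trans eq (sym (defect≡ k))))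

value-half : ∀ {b} c h q → b ≡ c + (h + h) → b + 2 * q ≡ c + ((h + q) + (h + q))
value-half c h q refl = lemma c h q
  where
  lemma : ∀ c h q → c + (h + h) + 2 * q ≡ c + ((h + q) + (h + q))
  lemma = solve-∀

span-arith : ∀ {l m b r q right} → suc q + r ≡ m → suc right ≡ l + m + b → l + r + (b + 2 * q) ≡ right + q
span-arith {l} {m} {b} {r} {q} {right} q+r≡m span = suc-injective (begin
  suc (l + r + (b + 2 * q))  ≡⟨ lemma l r b q ⟩
  l + (suc q + r) + b + q    ≡⟨ cong (λ x → l + x + b + q) q+r≡m ⟩
  l + m + b + q              ≡⟨ cong (_+ q) span ⟨
  suc right + q              ∎)
  where
  open ≡-Reasoning
  lemma : ∀ l r b q → suc (l + r + (b + 2 * q)) ≡ l + (suc q + r) + b + q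
  lemma = solve-∀

mirror-< : ∀ {q m} → q < m → m ∸ suc q < m
mirror-< {q} {m} q<m = subst (m ∸ suc q <_) (m+[n∸m]≡n q<m) (m<n+m (m ∸ suc q) (s≤s z≤n))

mirror : ∀ {q m} → q < m → m ∸ suc (m ∸ suc q) ≡ q
mirror {q} {m} q<m = begin
  m ∸ suc (m ∸ suc q)                      ≡⟨ cong (_∸ suc (m ∸ suc q)) (m+[n∸m]≡n q<m) ⟨
  suc q + (m ∸ suc q) ∸ suc (m ∸ suc q)    ≡⟨ m+n∸n≡m q (m ∸ suc q) ⟩
  q                                        ∎
  where open ≡-Reasoning

-- The values base + 2q (q < size), each placed at left + (size − 1 − q) and at right + q.
record Rainbow : Set where
  constructor rainbow
  field
    base size left right : Lin

open Rainbow

infix 4 _=ᴿ_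
_=ᴿ_ : Rainbow → Rainbow → Bool
rainbow b m l r =ᴿ rainbow b′ m′ l′ r′ = (b =ᴸ b′) ∧ (m =ᴸ m′) ∧ (l =ᴸ l′) ∧ (r =ᴸ r′)

=ᴿ-sound : ∀ R R′ → T (R =ᴿ R′) → R ≡ R′
=ᴿ-sound (rainbow b m l r) (rainbow b′ m′ l′ r′) eq =
  let b-eq , eq₁ = Equivalence.to (T-∧ {b =ᴸ b′}) eq
      m-eq , eq₂ = Equivalence.to (T-∧ {m =ᴸ m′}) eq₁
      l-eq , r-eq = Equivalence.to (T-∧ {l =ᴸ l′}) eq₂
  in rainbow-cong (=ᴸ-sound b b′ b-eq) (=ᴸ-sound m m′ m-eq) (=ᴸ-sound l l′ l-eq) (=ᴸ-sound r r′ r-eq)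
  where
  rainbow-cong : ∀ {b b′ m m′ l l′ r r′} → b ≡ b′ → m ≡ m′ → l ≡ l′ → r ≡ r′ →
                 rainbow b m l r ≡ rainbow b′ m′ l′ r′
  rainbow-cong refl refl refl refl = refl

data Arm : Set where
  leftArm rightArm : Rainbow → Arm
  hook : Lin → Arm

infix 4 _=ᴬ_
_=ᴬ_ : Arm → Arm → Bool
leftArm R =ᴬ leftArm R′ = R =ᴿ R′
rightArm R =ᴬ rightArm R′ = R =ᴿ R′
hook o =ᴬ hook o′ = o =ᴸ o′
_ =ᴬ _ = false

=ᴬ-sound : ∀ a a′ → T (a =ᴬ a′) → a ≡ a′
=ᴬ-sound (leftArm R) (leftArm R′) eq = cong leftArm (=ᴿ-sound R R′ eq)
=ᴬ-sound (rightArm R) (rightArm R′) eq = cong rightArm (=ᴿ-sound R R′ eq)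
=ᴬ-sound (hook o) (hook o′) eq = cong hook (=ᴸ-sound o o′ eq)

open BoolMembership _=ᴿ_ =ᴿ-sound renaming (_∈?_ to _∈ᴿ?_; ∈?-sound to ∈ᴿ?-sound)
open BoolMembership _=ᴬ_ =ᴬ-sound renaming (_∈?_ to _∈ᴬ?_; ∈?-sound to ∈ᴬ?-sound)

armStart armWidth : Arm → Lin
armStart (leftArm R) = left R
armStart (rightArm R) = right R
armStart (hook o) = o
armWidth (leftArm R) = size R
armWidth (rightArm R) = size R
armWidth (hook _) = # 1

armValue : ℕ → Arm → ℕ → ℕ
armValue t (leftArm R) r = ⟦ base R ⟧ t + 2 * (⟦ size R ⟧ t ∸ suc r)
armValue t (rightArm R) q = ⟦ base R ⟧ t + 2 * q
armValue t (hook _) _ = 0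

firstOccurrence : ℕ → Rainbow → ℕ → ℕ
firstOccurrence t R q = ⟦ left R ⟧ t + (⟦ size R ⟧ t ∸ suc q)

halfBase : Rainbow → Lin
halfBase = halfᴸ ∘ base

module Positions = Tiling armStart armWidth
module Halves = Tiling halfBase size

-- Positions are 0-based. `arms` lists the runs of the sequence from left to right, a hook being
-- the single 0 of a hooked sequence; `evens` and `odds` list the rainbows by increasing base and
-- tile the halves u of the values 2u ∈ [2, 2k − 2] and 2u + 1 ∈ [1, 2k + 1].
record Layout : Set where
  field
    k : Lin
    arms : List Arm
    evens odds : List Rainbow

  table : Parity → List Rainbow
  table even = evens
  table odd = odds

  rainbows : List Rainbow
  rainbows = evens ++ odds

  halfFrom halfTo : Parity → Lin
  halfFrom even = # 1
  halfFrom odd = # 0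
  halfTo even = k
  halfTo odd = # 1 ⊕ k

  tableTiles : Parity → Bool
  tableTiles π = Halves.tiles? (table π) (halfFrom π) (halfTo π)

  parityOK : Parity → Rainbow → Bool
  parityOK π R = base R =ᴸ # bit π ⊕ (halfBase R ⊕ halfBase R)

  spanOK lateOK placed : Rainbow → Bool
  spanOK R = right R ⊕ # 1 =ᴸ left R ⊕ size R ⊕ base R
  lateOK R = k ⊕ # 2 ≤ᴸ right R
  placed R = spanOK R ∧ lateOK R ∧ (leftArm R ∈ᴬ? arms) ∧ (rightArm R ∈ᴬ? arms)

  registered : Arm → Bool
  registered (leftArm R) = R ∈ᴿ? rainbows
  registered (rightArm R) = R ∈ᴿ? rainbows
  registered (hook _) = true

  hookedAt : Lin → Arm → Bool
  hookedAt L (hook o) = o ⊕ # 2 =ᴸ L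
  hookedAt L _ = true

record ValidLayout (ℓ : Layout) (L : Lin) : Set where
  open Layout ℓ
  field
    arms-tile : T (Positions.tiles? arms (# 0) L)
    evens-tile : T (tableTiles even)
    odds-tile : T (tableTiles odd)
    evens-parity : T (all (parityOK even) evens)
    odds-parity : T (all (parityOK odd) odds)
    all-placed : T (all placed rainbows)
    all-registered : T (all registered arms)
    hooks-at : T (all (hookedAt L) arms)

module LayoutFacts {ℓ : Layout} {L : Lin} (valid : ValidLayout ℓ L) (t : ℕ) where
  open Layout ℓ
  open ValidLayout valid

  kₜ Lₜ : ℕ
  kₜ = ⟦ k ⟧ t
  Lₜ = ⟦ L ⟧ t

  baseₜ sizeₜ leftₜ rightₜ halfₜ : Rainbow → ℕ
  baseₜ R = ⟦ base R ⟧ t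
  sizeₜ R = ⟦ size R ⟧ t
  leftₜ R = ⟦ left R ⟧ t
  rightₜ R = ⟦ right R ⟧ t
  halfₜ R = ⟦ halfBase R ⟧ t

  H : ℕ → Set
  H = NearSet (2 * kₜ + 1) ((2 * kₜ + 1) ∸ 1)

  s : ℕ → ℕ
  s = Positions.lookupAt t (armValue t) arms

  first : ℕ → ℕ
  first = byParity (λ π → Halves.lookupAt t (firstOccurrence t) (table π))

  Hole : ℕ → Set
  Hole p = ∃ λ o → hook o ∈ arms × p ≡ ⟦ o ⟧ t

  arms-tiling : Positions.Tiles t (armValue t) arms 0 Lₜ
  arms-tiling = Positions.tiles?-sound t (armValue t) arms (# 0) L arms-tile

  table-tiling : ∀ π → Halves.Tiles t (firstOccurrence t) (table π) (lowestHalf π) (halfBound π kₜ)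
  table-tiling even = Halves.tiles?-sound t (firstOccurrence t) evens (# 1) k evens-tile
  table-tiling odd = Halves.tiles?-sound t (firstOccurrence t) odds (# 0) (# 1 ⊕ k) odds-tile

  base-parity : ∀ π {R} → R ∈ table π → baseₜ R ≡ bit π + (halfₜ R + halfₜ R)
  base-parity π {R} R∈ = begin
    baseₜ R                    ≡⟨ ⟦⟧-cong (base R) (# bit π ⊕ twice) (All.lookup (parities π) R∈) t ⟩
    ⟦ # bit π ⊕ twice ⟧ t      ≡⟨ ⟦⊕⟧ (# bit π) twice t ⟩
    bit π + 0 + ⟦ twice ⟧ t    ≡⟨ cong₂ _+_ (+-identityʳ (bit π)) (⟦⊕⟧ (halfBase R) (halfBase R) t) ⟩
    bit π + (halfₜ R + halfₜ R) ∎
    where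
    open ≡-Reasoning
    twice = halfBase R ⊕ halfBase R
    parities : ∀ π → All (T ∘ parityOK π) (table π)
    parities even = all⁺ (parityOK even) evens evens-parity
    parities odd = all⁺ (parityOK odd) odds odds-parity

  in-table : ∀ {R} → R ∈ rainbows → ∃ λ π → R ∈ table π
  in-table R∈ with ∈-++⁻ evens R∈
  ... | inj₁ R∈evens = even , R∈evens
  ... | inj₂ R∈odds = odd , R∈odds

  table⊆rainbows : ∀ π {R} → R ∈ table π → R ∈ rainbows
  table⊆rainbows even = ∈-++⁺ˡ
  table⊆rainbows odd = ∈-++⁺ʳ evens

  record Placement (R : Rainbow) : Set where
    field
      span : suc (rightₜ R) ≡ leftₜ R + sizeₜ R + baseₜ R
      late : kₜ + 2 ≤ rightₜ R
      left∈ : leftArm R ∈ arms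
      right∈ : rightArm R ∈ arms

  placement : ∀ {R} → R ∈ rainbows → Placement R
  placement {R} R∈ = record
    { span = begin
        suc (rightₜ R)                 ≡⟨ +-comm 1 (rightₜ R) ⟩
        rightₜ R + 1                   ≡⟨ ⟦⊕⟧ (right R) (# 1) t ⟨
        ⟦ right R ⊕ # 1 ⟧ t            ≡⟨ ⟦⟧-cong (right R ⊕ # 1) (left R ⊕ size R ⊕ base R) span-ok t ⟩
        ⟦ left R ⊕ size R ⊕ base R ⟧ t ≡⟨ ⟦⊕⟧ (left R ⊕ size R) (base R) t ⟩
        ⟦ left R ⊕ size R ⟧ t + baseₜ R ≡⟨ cong (_+ baseₜ R) (⟦⊕⟧ (left R) (size R) t) ⟩
        leftₜ R + sizeₜ R + baseₜ R    ∎
    ; late = subst (_≤ rightₜ R) (⟦⊕⟧ k (# 2) t) (⟦⟧-mono {k ⊕ # 2} {right R} late-ok t)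
    ; left∈ = ∈ᴬ?-sound (leftArm R) arms left-ok
    ; right∈ = ∈ᴬ?-sound (rightArm R) arms right-ok
    }
    where
    open ≡-Reasoning
    checks = split₄ (spanOK R) (lateOK R) (leftArm R ∈ᴬ? arms) (rightArm R ∈ᴬ? arms)
                    (All.lookup (all⁺ placed rainbows all-placed) R∈)
    span-ok = proj₁ checks
    late-ok = proj₁ (proj₂ checks)
    left-ok = proj₁ (proj₂ (proj₂ checks))
    right-ok = proj₂ (proj₂ (proj₂ checks))

  registration : ∀ {a} → a ∈ arms → T (registered a)
  registration = All.lookup (all⁺ registered arms all-registered)

  hook-position : ∀ {o} → hook o ∈ arms → ⟦ o ⟧ t + 2 ≡ Lₜ
  hook-position {o} hook∈ =
    trans (sym (⟦⊕⟧ o (# 2) t))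
          (⟦⟧-cong (o ⊕ # 2) L (All.lookup (all⁺ (hookedAt L) arms hooks-at) hook∈) t)

  first-at : ∀ π {R q} → R ∈ table π → q < sizeₜ R → first (baseₜ R + 2 * q) ≡ firstOccurrence t R q
  first-at π {R} {q} R∈ q<m = begin
    first (baseₜ R + 2 * q)
      ≡⟨ cong first (value-half (bit π) (halfₜ R) q (base-parity π R∈)) ⟩
    first (bit π + ((halfₜ R + q) + (halfₜ R + q)))
      ≡⟨ byParity-at _ π (halfₜ R + q) ⟩
    Halves.lookupAt t (firstOccurrence t) (table π) (halfₜ R + q)
      ≡⟨ Halves.lookupAt-∈ t (firstOccurrence t) (table-tiling π) R∈ q<m ⟩
    firstOccurrence t R q
      ∎
    where open ≡-Reasoning

  value-near : ∀ π {R q} → R ∈ table π → q < sizeₜ R → H (baseₜ R + 2 * q)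
  value-near π {R} {q} R∈ q<m =
    subst H (sym (value-half (bit π) (halfₜ R) q (base-parity π R∈)))
      (near-by-half kₜ π (halfₜ R + q) (≤-trans low (m≤m+n (halfₜ R) q))
                    (<-≤-trans (+-monoʳ-< (halfₜ R) q<m) high))
    where
    low = proj₁ (Halves.tiles-bounds t (firstOccurrence t) (table-tiling π) R∈)
    high = proj₂ (Halves.tiles-bounds t (firstOccurrence t) (table-tiling π) R∈)

  span-at : ∀ {R q} → R ∈ rainbows → q < sizeₜ R →
            firstOccurrence t R q + (baseₜ R + 2 * q) ≡ rightₜ R + q
  span-at {R} R∈ q<m = span-arith {leftₜ R} {b = baseₜ R} (m+[n∸m]≡n q<m) (Placement.span (placement R∈))

  s-left : ∀ {R r} → leftArm R ∈ arms → r < sizeₜ R →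
           s (leftₜ R + r) ≡ baseₜ R + 2 * (sizeₜ R ∸ suc r)
  s-left = Positions.lookupAt-∈ t (armValue t) arms-tiling

  s-right : ∀ {R q} → rightArm R ∈ arms → q < sizeₜ R → s (rightₜ R + q) ≡ baseₜ R + 2 * q
  s-right = Positions.lookupAt-∈ t (armValue t) arms-tiling

  Paired : ℕ → Set
  Paired h = s (first h) ≡ h × s (first h + h) ≡ h × first h + h < Lₜ × kₜ + 2 ≤ first h + h

  rainbow-paired : ∀ π {R q} → R ∈ table π → q < sizeₜ R → Paired (baseₜ R + 2 * q)
  rainbow-paired π {R} {q} R∈ q<m =
    trans (cong s (first-at π R∈ q<m))
          (trans (s-left left∈ (mirror-< q<m)) (cong (λ x → baseₜ R + 2 * x) (mirror q<m))) ,
    trans (cong s second≡) (s-right right∈ q<m) ,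
    subst (_< Lₜ) (sym second≡)
      (<-≤-trans (+-monoʳ-< (rightₜ R) q<m)
                 (proj₂ (Positions.tiles-bounds t (armValue t) arms-tiling right∈))) ,
    subst (kₜ + 2 ≤_) (sym second≡) (≤-trans late (m≤m+n (rightₜ R) q))
    where
    open Placement (placement (table⊆rainbows π R∈))
    second≡ : first (baseₜ R + 2 * q) + (baseₜ R + 2 * q) ≡ rightₜ R + q
    second≡ = trans (cong (_+ (baseₜ R + 2 * q)) (first-at π R∈ q<m)) (span-at (table⊆rainbows π R∈) q<m)

  pairs : ∀ {h} → H h → Paired h
  pairs {h} hh with half-of-near kₜ h hh
  ... | π , u , refl , low≤u , u<bound
    with Halves.tiles-locate t (firstOccurrence t) (table-tiling π) low≤u u<bound
  ...   | R , R∈ , q , q<m , refl =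
    subst Paired (value-half (bit π) (halfₜ R) q (base-parity π R∈)) (rainbow-paired π R∈ q<m)

  hole-zero : ∀ {p} → Hole p → s p ≡ 0
  hole-zero (o , hook∈ , refl) =
    trans (cong s (sym (+-identityʳ (⟦ o ⟧ t))))
          (Positions.lookupAt-∈ t (armValue t) arms-tiling hook∈ (s≤s z≤n))

  covers : ∀ {p} → p < Lₜ → Hole p ⊎ H (s p) × (p ≡ first (s p) ⊎ p ≡ first (s p) + s p)
  covers p<L with Positions.tiles-locate t (armValue t) arms-tiling z≤n p<L
  ... | hook o , hook∈ , zero , _ , p≡ = inj₁ (o , hook∈ , trans p≡ (+-identityʳ (⟦ o ⟧ t)))
  ... | hook _ , _ , suc _ , s≤s () , _
  ... | leftArm R , left∈ , r , r<m , refl with in-table (∈ᴿ?-sound R rainbows (registration left∈))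
  ...   | π , R∈ = inj₂ (subst H (sym s≡) (value-near π R∈ q<m) , inj₁ (sym first≡))
    where
    q<m = mirror-< r<m
    s≡ : s (leftₜ R + r) ≡ baseₜ R + 2 * (sizeₜ R ∸ suc r)
    s≡ = s-left left∈ r<m
    first≡ : first (s (leftₜ R + r)) ≡ leftₜ R + r
    first≡ = trans (cong first s≡) (trans (first-at π R∈ q<m) (cong (leftₜ R +_) (mirror r<m)))
  covers _ | rightArm R , right∈ , q , q<m , refl with in-table (∈ᴿ?-sound R rainbows (registration right∈))
  ...   | π , R∈ = inj₂ (subst H (sym s≡) (value-near π R∈ q<m) , inj₂ (sym second≡))
    where
    s≡ : s (rightₜ R + q) ≡ baseₜ R + 2 * q
    s≡ = s-right right∈ q<m
    second≡ : first (s (rightₜ R + q)) + s (rightₜ R + q) ≡ rightₜ R + q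
    second≡ = trans (cong (λ v → first v + v) s≡)
                    (trans (cong (_+ (baseₜ R + 2 * q)) (first-at π R∈ q<m))
                           (span-at (table⊆rainbows π R∈) q<m))

  pairs-within : ∀ {L′} → Lₜ ≡ L′ → ∀ {h} → H h →
                 s (first h) ≡ h × s (first h + h) ≡ h × first h + h < L′ × kₜ + 2 ≤ first h + h
  pairs-within refl = pairs

  covers-within : ∀ {L′} → Lₜ ≡ L′ → ∀ {p} → p < L′ →
                  Hole p ⊎ H (s p) × (p ≡ first (s p) ⊎ p ≡ first (s p) + s p)
  covers-within refl = covers

isHook : Arm → Bool
isHook (hook _) = true
isHook _ = false

fourTimes : Lin → Lin
fourTimes x = x ⊕ x ⊕ x ⊕ x

⟦fourTimes⟧ : ∀ x t → ⟦ fourTimes x ⟧ t ≡ 2 * ((2 * ⟦ x ⟧ t + 1) ∸ 1)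
⟦fourTimes⟧ (lin a b) t rewrite defect≡ (a + b * t) = lemma a b t
  where
  lemma : ∀ a b t → a + a + a + a + (b + b + b + b) * t ≡ 2 * (a + b * t + (a + b * t))
  lemma = solve-∀

NearSkolemWitness HookedNearSkolemWitness : ℕ → Set
NearSkolemWitness k =
  Σ (Fin (2 * ((2 * k + 1) ∸ 1)) → ℕ) λ s →
    IsNearSkolem (2 * k + 1) ((2 * k + 1) ∸ 1) s ×
    NoRightEndpointUpTo (NearSet (2 * k + 1) ((2 * k + 1) ∸ 1)) s (k + 2)
HookedNearSkolemWitness k =
  Σ (Fin (suc (2 * ((2 * k + 1) ∸ 1))) → ℕ) λ s →
    IsHookedNearSkolem (2 * k + 1) ((2 * k + 1) ∸ 1) s ×
    NoRightEndpointUpTo (NearSet (2 * k + 1) ((2 * k + 1) ∸ 1)) s (k + 2)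

near-skolem : ∀ ℓ → ValidLayout ℓ (fourTimes (Layout.k ℓ)) → T (all (not ∘ isHook) (Layout.arms ℓ)) →
              ∀ t → NearSkolemWitness (⟦ Layout.k ℓ ⟧ t)
near-skolem ℓ valid no-hooks t = seq , (occurs , filled) , no-early-right-endpoint
  where
  open Layout ℓ using (k; arms)
  open LayoutFacts valid t
  L≡ : Lₜ ≡ 2 * ((2 * kₜ + 1) ∸ 1)
  L≡ = ⟦fourTimes⟧ k t
  open Pairing s first (2 * ((2 * kₜ + 1) ∸ 1)) (kₜ + 2) proj₁ hole-zero
    (pairs-within L≡) (covers-within L≡)
  filled : ∀ p → H (seq p)
  filled p with covers-within L≡ (toℕ<n p)
  ... | inj₁ (_ , hook∈ , _) = contradiction (All.lookup (all⁺ (not ∘ isHook) arms no-hooks) hook∈) λ ()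
  ... | inj₂ (hp , _) = hp

hooked-near-skolem : ∀ ℓ → ValidLayout ℓ (# 1 ⊕ fourTimes (Layout.k ℓ)) → T (any isHook (Layout.arms ℓ)) →
                     ∀ t → HookedNearSkolemWitness (⟦ Layout.k ℓ ⟧ t)
hooked-near-skolem ℓ valid some-hook t = seq , (occurs , zero-at-hook , filled) , no-early-right-endpoint
  where
  open Layout ℓ using (k; arms)
  open LayoutFacts valid t
  m = 2 * ((2 * kₜ + 1) ∸ 1)
  L≡ : Lₜ ≡ suc m
  L≡ = cong suc (⟦fourTimes⟧ k t)
  open Pairing s first (suc m) (kₜ + 2) proj₁ hole-zero
    (pairs-within L≡) (covers-within L≡)
  hole-before-last : ∀ {p} → Hole p → suc p ≡ m
  hole-before-last (o , hook∈ , refl) =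
    suc-injective (trans (+-comm 2 (⟦ o ⟧ t)) (trans (hook-position hook∈) L≡))
  zero-at-hook : ∀ p → pos p ≡ m → seq p ≡ 0
  zero-at-hook p pos≡m with find (any⁻ isHook arms some-hook)
  ... | hook o , hook∈ , _ =
    hole-zero (o , hook∈ , suc-injective (trans pos≡m (sym (hole-before-last (o , hook∈ , refl)))))
  filled : ∀ p → pos p ≢ m → H (seq p)
  filled p pos≢m with covers-within L≡ (toℕ<n p)
  ... | inj₁ hole = contradiction (hole-before-last hole) pos≢m
  ... | inj₂ (hp , _) = hp

hookedLayout : Layout
hookedLayout = record
  { k = lin 6 2
  ; arms = leftArm r3 ∷ leftArm r8+4t ∷ rightArm r3 ∷ leftArm r6+2t ∷ leftArm r4 ∷ rightArm r8+4t ∷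
           leftArm r4+2t ∷ rightArm r4 ∷ leftArm r1 ∷ rightArm r1 ∷ rightArm r6+2t ∷ rightArm r4+2t ∷
           leftArm r2 ∷ hook (lin 23 8) ∷ rightArm r2 ∷ []
  ; evens = r2 ∷ r4 ∷ r4+2t ∷ r6+2t ∷ r8+4t ∷ []
  ; odds = r1 ∷ r3 ∷ []
  }
  where
  r1 = rainbow (# 1) (# 1) (lin 18 7) (lin 19 7)
  r2 = rainbow (# 2) (# 1) (lin 22 8) (lin 24 8)
  r3 = rainbow (# 3) (lin 6 2) (# 0) (lin 8 2)
  r4 = rainbow (# 4) (lin 0 1) (lin 15 5) (lin 18 6)
  r4+2t = rainbow (lin 4 2) (# 1) (lin 17 6) (lin 21 8)
  r6+2t = rainbow (lin 6 2) (lin 1 1) (lin 14 4) (lin 20 7)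
  r8+4t = rainbow (lin 8 4) (# 2) (lin 6 2) (lin 15 6)

plainLayout : Layout
plainLayout = record
  { k = lin 5 2
  ; arms = leftArm r3 ∷ leftArm r6+4t ∷ rightArm r3 ∷ leftArm r6+2t ∷ leftArm r4 ∷ rightArm r6+4t ∷
           leftArm r4+2t ∷ rightArm r4 ∷ leftArm r1 ∷ rightArm r1 ∷ rightArm r6+2t ∷ leftArm r2 ∷
           rightArm r4+2t ∷ rightArm r2 ∷ []
  ; evens = r2 ∷ r4 ∷ r4+2t ∷ r6+2t ∷ r6+4t ∷ []
  ; odds = r1 ∷ r3 ∷ []
  }
  where
  r1 = rainbow (# 1) (# 1) (lin 15 7) (lin 16 7)
  r2 = rainbow (# 2) (# 1) (lin 17 8) (lin 19 8)
  r3 = rainbow (# 3) (lin 5 2) (# 0) (lin 7 2)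
  r4 = rainbow (# 4) (lin 0 1) (lin 12 5) (lin 15 6)
  r4+2t = rainbow (lin 4 2) (# 1) (lin 14 6) (lin 18 8)
  r6+2t = rainbow (lin 6 2) (lin 0 1) (lin 12 4) (lin 17 7)
  r6+4t = rainbow (lin 6 4) (# 2) (lin 5 2) (lin 12 6)

five-plus-parity : ∀ k → 5 ≤ k → (∃ λ t → k ≡ 6 + 2 * t) ⊎ (∃ λ t → k ≡ 5 + 2 * t)
five-plus-parity k 5≤k with parity k
... | even , u , refl with m≤n⇒∃[o]m+o≡n (halve-< {2} {u} 5≤k)
...   | t , refl = inj₁ (t , lemma t)
  where
  lemma : ∀ t → (3 + t) + (3 + t) ≡ 6 + 2 * t
  lemma = solve-∀
five-plus-parity k 5≤k | odd , u , refl
  with m≤n⇒∃[o]m+o≡n (halve-< {1} {u} (≤-trans (n≤1+n 3) (s≤s⁻¹ 5≤k)))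
...   | t , refl = inj₂ (t , lemma t)
  where
  lemma : ∀ t → suc ((2 + t) + (2 + t)) ≡ 5 + 2 * t
  lemma = solve-∀

lemma2p4 : (k : ℕ) → 5 ≤ k →
    (Σ (Fin (2 * ((2 * k + 1) ∸ 1)) → ℕ) λ s →
       IsNearSkolem (2 * k + 1) ((2 * k + 1) ∸ 1) s ×
       NoRightEndpointUpTo (NearSet (2 * k + 1) ((2 * k + 1) ∸ 1)) s (k + 2))
    ⊎
    (Σ (Fin (suc (2 * ((2 * k + 1) ∸ 1))) → ℕ) λ s →
       IsHookedNearSkolem (2 * k + 1) ((2 * k + 1) ∸ 1) s ×
       NoRightEndpointUpTo (NearSet (2 * k + 1) ((2 * k + 1) ∸ 1)) s (k + 2))
lemma2p4 k 5≤k with five-plus-parity k 5≤k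
... | inj₁ (t , refl) = inj₂ (hooked-near-skolem hookedLayout _ _ t)
... | inj₂ (t , refl) = inj₁ (near-skolem plainLayout _ _ t)
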